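{- Let $I\subseteq\{0,\dots,d\}$. (1) If $d\notin I$, then $\Diamond^d(\Gamma^d_I)=\{d,v_d\}*\Diamond^{d-1}(\Gamma^{d-1}_I)$, where $\{d,v_d\}$ denotes the $0$-dimensional complex consisting of the two vertices $d$ and $v_d$. (2) If $0\notin I$, then $\Diamond^d(\Gamma^d_I)=\{0\}*\pi(\Diamond^{d-1}(\Gamma^{d-1}_{I-1}))$, where $I-1=\{i-1:i\in I\}$ and $\pi:\{0,\dots,d-1\}\cup\{v_0,\dots,v_{d-1}\}\to\{1,\dots,d\}\cup\{v_1,\dots,v_d\}$ is given by $i\mapsto i+1$, $v_i\mapsto v_{i+1}$.
   Context: For $n\ge0$, $\sigma^{n+1}$ is the simplex on $\{0,\dots,n+1\}$, $\Gamma^n_i=\{0,\dots,n+1\}\setminus\{i\}$, and $\Gamma^n_I$ is the subcomplex of $\partial\sigma^{n+1}$ generated by $\{\Gamma^n_i:i\in I\}$. For a pure $n$-dimensional subcomplex $\Gamma\subseteq\partial\sigma^{n+1}$, $\Diamond^n(\Gamma)$ is obtained by, for $i=0,1,\dots,n$ in order, stellarly subdividing the current complex $K$ at $F_i=\{i+1,\dots,n+1\}$ whenever $F_i\in K$, i.e. replacing $K$ by $(K\setminus F_i)\cup(\langle v_i\rangle*\partial F_i*\mathrm{lk}_K(F_i))$ with new vertex $v_i$; it is a subcomplex of the boundary of the cross-polytope on $\{0,\dots,n\}\cup\{v_0,\dots,v_n\}$. $*$ denotes join. -}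

module Defs where

open import Data.Nat using (ℕ; zero; suc; _+_; _∸_; _≤_)
open import Data.List using (List; []; _∷_; _++_; map; upTo)
open import Data.List.Membership.Propositional using (_∈_; _∉_)
open import Data.Product using (_×_; Σ; ∃; ∃-syntax; _,_)
open import Data.Sum using (_⊎_)
open import Relation.Nullary using (¬_)
open import Data.Empty using (⊥)
open import Relation.Binary.PropositionalEquality using (_≡_)

-- Vertices: the original vertices i (orig i) and the new vertices v_i (new i).
data V : Set where
  orig : ℕ → V
  new  : ℕ → V

-- A face is a finite set of vertices, represented by a list (order and
-- repetitions irrelevant; all notions below only use membership).
Face : Set
Face = List V

_⊆_ : Face → Face → Set
σ ⊆ τ = ∀ {x} → x ∈ σ → x ∈ τ

_≈_ : Face → Face → Set
σ ≈ τ = (σ ⊆ τ) × (τ ⊆ σ)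

-- A (possibly void) simplicial complex, given by its membership predicate on faces.
Complex : Set₁
Complex = Face → Set

_≐_ : Complex → Complex → Set
K ≐ L = ∀ σ → (K σ → L σ) × (L σ → K σ)

inΓfacet : ℕ → ℕ → V → Set
inΓfacet n i (orig j) = (j ≤ suc n) × ¬ (j ≡ i)
inΓfacet n i (new j)  = ⊥

-- Γ^n_I : the subcomplex of ∂σ^{n+1} generated by the facets Γ^n_i, i ∈ I
-- (void complex when I = ∅).
Γ : ℕ → List ℕ → Complex
Γ n I σ = ∃[ i ] (i ∈ I) × (∀ {x} → x ∈ σ → inΓfacet n i x)

-- F_i = {i+1, …, n+1}
Fset : ℕ → ℕ → Face
Fset n i = map (λ j → orig (suc i + j)) (upTo (suc (n ∸ i)))

-- Stellar subdivision of K at F with new vertex v: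
--   (K ∖ F) ∪ (⟨v⟩ * ∂F * lk_K(F)),
-- where K ∖ F removes all faces containing F and
-- lk_K(F) = {B : B ∩ F = ∅, B ∪ F ∈ K}.
-- (If F ∉ K this is K itself, matching "whenever F ∈ K".)
stellar : Complex → Face → V → Complex
stellar K F v σ =
  (K σ × ¬ (F ⊆ σ))
  ⊎ (∃[ A ] ∃[ B ] ((A ⊆ F) × ¬ (F ⊆ A))
                 × (∀ {x} → x ∈ B → x ∉ F) × K (F ++ B)
                 × (σ ⊆ (v ∷ A ++ B)))

-- after k steps (steps i = 0,…,k-1)
steps : ℕ → ℕ → Complex → Complex
steps n zero    K = K
steps n (suc k) K = stellar (steps n k K) (Fset n k) (new k)

Diamond : ℕ → Complex → Complex
Diamond n K = steps n (suc n) K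

_✶_ : Complex → Complex → Complex
(K ✶ L) σ = ∃[ A ] ∃[ B ] K A × L B × (σ ≈ (A ++ B))

twoPts : V → V → Complex
twoPts x y σ = (σ ⊆ (x ∷ [])) ⊎ (σ ⊆ (y ∷ []))

onePt : V → Complex
onePt x σ = σ ⊆ (x ∷ [])

πv : V → V
πv (orig i) = orig (suc i)
πv (new i)  = new (suc i)

image : (V → V) → Complex → Complex
image f K σ = ∃[ τ ] K τ × (σ ≈ map f τ)

shiftDown : List ℕ → List ℕ
shiftDown = map (_∸ 1)

-- Induction on the subdivision steps: after k steps, the faces coming from a facet Γ^n_i are
-- exactly those with vertices in Γ^n_i ∪ {v_i,…,v_{k-1}} (F_j ⊆ Γ^n_i iff i ≤ j) that contain no
-- antipodal pair {j, v_j} and do not contain the last centre F_{k-1}. At k = n+1 the last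
-- condition only removes the vertex n+1, so ◇^n(Γ^n_I) is the union over i ∈ I of the full
-- subcomplexes of the cross-polytope boundary on ({0,…,n}∖{i}) ∪ {v_i,…,v_n}. Both identities
-- then come from splitting such a face by the level of its vertices (j and v_j have level j):
-- level d in (1), level 0 in (2).
module Submission where

open import Defs
open import Data.Nat using (ℕ; zero; suc; _≤_; _<_; _∸_; _+_; z≤n; s≤s; _≟_; _≤?_)
open import Data.Nat.Properties
open import Data.List using (List; []; _∷_; _++_; map; filter)
open import Data.List.Relation.Unary.All using (All)
import Data.List.Relation.Unary.All as All
import Data.List.Relation.Unary.All.Properties as All
open import Data.List.Relation.Unary.Any using (here; there)
open import Data.List.Membership.Propositional using (_∈_; _∉_)
open import Data.List.Membership.Propositional.Properties
  using (∈-map⁺; ∈-map⁻; ∈-++⁺ˡ; ∈-++⁺ʳ; ∈-++⁻; ∈-filter⁺; ∈-filter⁻; ∈-upTo⁺; ∈-upTo⁻)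
open import Data.Product using (_×_; _,_; proj₁; proj₂; ∃-syntax)
open import Data.Sum using (_⊎_; inj₁; inj₂; [_,_])
open import Data.Unit using (⊤; tt)
open import Data.Empty using (⊥; ⊥-elim)
open import Function using (_∘_)
open import Relation.Nullary using (¬_; yes; no)
open import Relation.Nullary.Decidable using (¬?; map′)
open import Relation.Unary using (Pred; Decidable)
open import Relation.Binary.PropositionalEquality using (_≡_; _≢_; refl; sym; trans; cong; subst)
open import Relation.Binary.Definitions using (DecidableEquality)

variable
  n k e i j : ℕ
  x : V
  σ τ A B : Face
  I : List ℕ
  K L M : Complex
  P : Pred V _

≐-sym : K ≐ L → L ≐ K
≐-sym K≐L σ = proj₂ (K≐L σ) , proj₁ (K≐L σ)

≐-trans : K ≐ L → L ≐ M → K ≐ M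
≐-trans K≐L L≐M σ = proj₁ (L≐M σ) ∘ proj₁ (K≐L σ) , proj₂ (K≐L σ) ∘ proj₂ (L≐M σ)

stellar-mono : ∀ {F v} → (∀ {τ} → K τ → L τ) → stellar K F v σ → stellar L F v σ
stellar-mono K⊆L (inj₁ (kσ , F⊄σ))              = inj₁ (K⊆L kσ , F⊄σ)
stellar-mono K⊆L (inj₂ (A , B , a , b , kFB , c)) = inj₂ (A , B , a , b , K⊆L kFB , c)

stellar-cong : ∀ {F v} → K ≐ L → stellar K F v ≐ stellar L F v
stellar-cong K≐L σ = stellar-mono (proj₁ (K≐L _)) , stellar-mono (proj₂ (K≐L _))

✶-congʳ : L ≐ M → (K ✶ L) ≐ (K ✶ M)
✶-congʳ L≐M σ = (λ (A , B , a , b , s) → A , B , a , proj₁ (L≐M B) b , s)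
              , (λ (A , B , a , b , s) → A , B , a , proj₂ (L≐M B) b , s)

image-cong : ∀ {f} → K ≐ L → image f K ≐ image f L
image-cong K≐L σ = (λ (τ , k , s) → τ , proj₁ (K≐L τ) k , s)
                 , (λ (τ , l , s) → τ , proj₂ (K≐L τ) l , s)

_≟V_ : DecidableEquality V
orig a ≟V orig b = map′ (cong orig) (λ { refl → refl }) (a ≟ b)
orig _ ≟V new _  = no λ ()
new _  ≟V orig _ = no λ ()
new a  ≟V new b  = map′ (cong new) (λ { refl → refl }) (a ≟ b)

open import Data.List.Membership.DecPropositional _≟V_ using (_∈?_)

filter-⊆ : (P? : Decidable P) (σ : Face) → filter P? σ ⊆ σ
filter-⊆ P? σ = proj₁ ∘ ∈-filter⁻ P? {xs = σ}

filter-holds : (P? : Decidable P) (σ : Face) → x ∈ filter P? σ → P x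
filter-holds P? σ = proj₂ ∘ ∈-filter⁻ P? {xs = σ}

filter-partition : (P? : Decidable P) → σ ≈ (filter P? σ ++ filter (¬? ∘ P?) σ)
filter-partition {σ = σ} P? = split , [ filter-⊆ P? σ , filter-⊆ (¬? ∘ P?) σ ] ∘ ∈-++⁻ (filter P? σ)
  where
  split : σ ⊆ (filter P? σ ++ filter (¬? ∘ P?) σ)
  split {x} p with P? x
  ... | yes px = ∈-++⁺ˡ (∈-filter⁺ P? p px)
  ... | no ¬px = ∈-++⁺ʳ _ (∈-filter⁺ (¬? ∘ P?) p ¬px)

✶-intro : (P? : Decidable P) → K (filter P? σ) → L (filter (¬? ∘ P?) σ) → (K ✶ L) σ
✶-intro P? kA lB = _ , _ , kA , lB , filter-partition P?

++-monoˡ-⊆ : A ⊆ τ → (A ++ B) ⊆ (τ ++ B)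
++-monoˡ-⊆ {A} {τ} A⊆τ = [ ∈-++⁺ˡ ∘ A⊆τ , ∈-++⁺ʳ τ ] ∘ ∈-++⁻ A

map-retraction : ∀ {f g : V → V} → (∀ {x} → x ∈ σ → f (g x) ≡ x) → σ ≈ map f (map g σ)
map-retraction {f = f} {g} fg = (λ p → subst (_∈ _) (fg p) (∈-map⁺ f (∈-map⁺ g p))) , back
  where
  back : map f (map g _) ⊆ _
  back q with ∈-map⁻ f q
  ... | y , y∈ , refl with ∈-map⁻ g y∈
  ...   | x , x∈ , refl = subst (_∈ _) (sym (fg x∈)) x∈

new∉Fset : new j ∉ Fset n k
new∉Fset {k = k} p with ∈-map⁻ (λ m → orig (suc k + m)) p
... | _ , _ , ()

∈Fset⁻ : k ≤ n → orig j ∈ Fset n k → k < j × j ≤ suc n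
∈Fset⁻ {k} k≤n p with ∈-map⁻ (λ m → orig (suc k + m)) p
... | m , m∈ , refl =
  s≤s (m≤m+n k m) , s≤s (subst (k + m ≤_) (m+[n∸m]≡n k≤n) (+-monoʳ-≤ k (≤-pred (∈-upTo⁻ m∈))))

∈Fset⁺ : k < j → j ≤ suc n → orig j ∈ Fset n k
∈Fset⁺ {k} {j} k<j j≤ =
  subst (λ m → orig m ∈ Fset _ k) (m+[n∸m]≡n k<j)
    (∈-map⁺ (λ m → orig (suc k + m)) (∈-upTo⁺ (s≤s (∸-monoˡ-≤ (suc k) j≤))))

orig∉Fset-self : k ≤ n → orig k ∉ Fset n k
orig∉Fset-self k≤n p = <-irrefl refl (proj₁ (∈Fset⁻ k≤n p))

Fset-suc-⊆ : suc k ≤ n → Fset n (suc k) ⊆ Fset n k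
Fset-suc-⊆ k<n {orig j} p = let k<j , j≤ = ∈Fset⁻ k<n p in ∈Fset⁺ (<⇒≤ k<j) j≤
Fset-suc-⊆ {n = n} _ {new j} p = ⊥-elim (new∉Fset {n = n} p)

∈Fset-split : suc k ≤ n → x ∈ Fset n k → x ∈ Fset n (suc k) ⊎ x ≡ orig (suc k)
∈Fset-split {k} {x = orig j} k<n p with ∈Fset⁻ (<⇒≤ k<n) p
... | k<j , j≤ with m≤n⇒m<n∨m≡n k<j
...   | inj₁ 1+k<j = inj₁ (∈Fset⁺ 1+k<j j≤)
...   | inj₂ refl  = inj₂ refl
∈Fset-split {x = new j} _ p = ⊥-elim (new∉Fset p)

Fset-top : x ∈ Fset n n → x ≡ orig (suc n)
Fset-top {x = orig j} p = let n<j , j≤ = ∈Fset⁻ ≤-refl p in cong orig (≤-antisym j≤ n<j)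
Fset-top {x = new j}  p = ⊥-elim (new∉Fset p)

Fset-⊆⇒≤ : orig i ∉ σ → i ≤ suc n → Fset n k ⊆ σ → i ≤ k
Fset-⊆⇒≤ {i} {k = k} i∉σ i≤ F⊆σ with i ≤? k
... | yes i≤k = i≤k
... | no  i≰k = ⊥-elim (i∉σ (F⊆σ (∈Fset⁺ (≰⇒> i≰k) i≤)))

level : V → ℕ
level (orig j) = j
level (new j)  = j

level-πv : ∀ y → level (πv y) ≡ suc (level y)
level-πv (orig j) = refl
level-πv (new j)  = refl

level-fibre : level x ≡ j → x ≡ orig j ⊎ x ≡ new j
level-fibre {orig j} refl = inj₁ refl
level-fibre {new j}  refl = inj₂ refl

-- Inverts πv away from level 0, where ∸ truncates.
unπ : V → V
unπ (orig j) = orig (j ∸ 1)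
unπ (new j)  = new (j ∸ 1)

πv-unπ : level x ≢ 0 → πv (unπ x) ≡ x
πv-unπ {orig zero}    0≢0 = ⊥-elim (0≢0 refl)
πv-unπ {orig (suc j)} _   = refl
πv-unπ {new zero}     0≢0 = ⊥-elim (0≢0 refl)
πv-unπ {new (suc j)}  _   = refl

NoAntipodes : Face → Set
NoAntipodes σ = ∀ {j} → orig j ∈ σ → new j ∈ σ → ⊥

noAntipodes-⊆ : τ ⊆ σ → NoAntipodes σ → NoAntipodes τ
noAntipodes-⊆ τ⊆σ anti o nw = anti (τ⊆σ o) (τ⊆σ nw)

noAntipodes-singleton : ∀ {c} → A ⊆ (c ∷ []) → NoAntipodes A
noAntipodes-singleton A⊆c o nw with A⊆c o | A⊆c nw
... | here refl | here ()

noAntipodes-∷new : orig j ∉ σ → NoAntipodes σ → NoAntipodes (new j ∷ σ)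
noAntipodes-∷new j∉σ anti (there o) (here refl) = j∉σ o
noAntipodes-∷new j∉σ anti (there o) (there nw)  = anti o nw

noAntipodes-++ : NoAntipodes A → NoAntipodes B →
  (∀ {x y} → x ∈ A → y ∈ B → level x ≢ level y) → NoAntipodes (A ++ B)
noAntipodes-++ {A} antiA antiB apart o nw with ∈-++⁻ A o | ∈-++⁻ A nw
... | inj₁ p | inj₁ q = antiA p q
... | inj₁ p | inj₂ q = apart p q refl
... | inj₂ p | inj₁ q = apart q p refl
... | inj₂ p | inj₂ q = antiB p q

-- Faces of steps n k (Γ^n_I) coming from the facet Γ^n_i.

StageVertex : ℕ → ℕ → ℕ → V → Set
StageVertex n k i (orig j) = j ≤ suc n × j ≢ i
StageVertex n k i (new j)  = i ≤ j × j < k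

AvoidsLastCentre : ℕ → ℕ → ℕ → Face → Set
AvoidsLastCentre n zero    i σ = ⊤
AvoidsLastCentre n (suc k) i σ = i ≤ k → ¬ (Fset n k ⊆ σ)

record StageFace (n k i : ℕ) (σ : Face) : Set where
  field
    vertices    : ∀ {x} → x ∈ σ → StageVertex n k i x
    noAntipodes : NoAntipodes σ
    avoidsLast  : AvoidsLastCentre n k i σ
open StageFace

Stage : ℕ → ℕ → List ℕ → Complex
Stage n k I σ = ∃[ i ] i ∈ I × StageFace n k i σ

stageVertex-suc : ∀ x → StageVertex n k i x → StageVertex n (suc k) i x
stageVertex-suc (orig j) v         = v
stageVertex-suc (new j)  (i≤j , j<k) = i≤j , m<n⇒m<1+n j<k

stageVertex-pred : ∀ x → x ≢ new k → StageVertex n (suc k) i x → StageVertex n k i x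
stageVertex-pred (orig j) _   v = v
stageVertex-pred (new j)  x≢v (i≤j , j≤k) with m≤n⇒m<n∨m≡n (≤-pred j≤k)
... | inj₁ j<k = i≤j , j<k
... | inj₂ refl = ⊥-elim (x≢v refl)

orig∉stageFace : StageFace n k i σ → orig i ∉ σ
orig∉stageFace s p = proj₂ (vertices s p) refl

avoidsLast-⊆ : τ ⊆ σ → AvoidsLastCentre n k i σ → AvoidsLastCentre n k i τ
avoidsLast-⊆ {k = zero}  τ⊆σ _ = tt
avoidsLast-⊆ {k = suc k} τ⊆σ a i≤k F⊆τ = a i≤k (τ⊆σ ∘ F⊆τ)

avoidsLast-of-orig∉ : k ≤ suc n → orig k ∉ σ → AvoidsLastCentre n k i σ
avoidsLast-of-orig∉ {k = zero}  _  _   = tt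
avoidsLast-of-orig∉ {k = suc k} k≤ k∉σ _ F⊆σ = k∉σ (F⊆σ (∈Fset⁺ ≤-refl k≤))

avoidsLast-of-centre⊄ : k ≤ n → ¬ (Fset n k ⊆ σ) → AvoidsLastCentre n k i σ
avoidsLast-of-centre⊄ {k = zero}  _   _   = tt
avoidsLast-of-centre⊄ {k = suc k} k<n F⊄σ _ F⊆σ = F⊄σ (F⊆σ ∘ Fset-suc-⊆ k<n)

avoidsLast-elim : k ≤ n → i < k → AvoidsLastCentre n k i σ → Fset n k ⊆ σ → orig k ∉ σ
avoidsLast-elim {suc k} k≤n (s≤s i≤k) a F⊆σ k∈σ =
  a i≤k ([ F⊆σ , (λ { refl → k∈σ }) ] ∘ ∈Fset-split k≤n)

stageFace-⊆ : τ ⊆ σ → StageFace n k i σ → StageFace n k i τ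
stageFace-⊆ τ⊆σ s = record
  { vertices    = vertices s ∘ τ⊆σ
  ; noAntipodes = noAntipodes-⊆ τ⊆σ (noAntipodes s)
  ; avoidsLast  = avoidsLast-⊆ τ⊆σ (avoidsLast s)
  }

centre⊄stageFace : i ≤ suc n → StageFace n (suc k) i σ → ¬ (Fset n k ⊆ σ)
centre⊄stageFace i≤ s F⊆σ = avoidsLast s (Fset-⊆⇒≤ (orig∉stageFace s) i≤ F⊆σ) F⊆σ

stageFace-keep : StageFace n k i σ → ¬ (Fset n k ⊆ σ) → StageFace n (suc k) i σ
stageFace-keep s F⊄σ = record
  { vertices    = λ {x} → stageVertex-suc x ∘ vertices s
  ; noAntipodes = noAntipodes s
  ; avoidsLast  = λ _ → F⊄σ
  }

stageFace-cone : i ≤ suc n → k ≤ n → A ⊆ Fset n k → ¬ (Fset n k ⊆ A) →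
  (∀ {x} → x ∈ B → x ∉ Fset n k) → StageFace n k i (Fset n k ++ B) →
  StageFace n (suc k) i (new k ∷ A ++ B)
stageFace-cone {i} {n} {k} {A} {B} i≤ k≤n A⊆F F⊄A B∩F s = record
  { vertices    = cone-vertex
  ; noAntipodes = noAntipodes-∷new k∉ (noAntipodes-⊆ AB⊆FB (noAntipodes s))
  ; avoidsLast  = λ _ F⊆cone → F⊄A (λ q → in-A q (F⊆cone q))
  }
  where
  F = Fset n k
  AB⊆FB : (A ++ B) ⊆ (F ++ B)
  AB⊆FB = ++-monoˡ-⊆ A⊆F
  i≤k : i ≤ k
  i≤k = Fset-⊆⇒≤ (orig∉stageFace s) i≤ ∈-++⁺ˡ
  -- For i < k the old stage already avoids F_{k-1} = F_k ∪ {k}; for i = k, k is not a vertex.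
  k∉ : orig k ∉ A ++ B
  k∉ p with ∈-++⁻ A p | m≤n⇒m<n∨m≡n i≤k
  ... | inj₁ q | _         = orig∉Fset-self k≤n (A⊆F q)
  ... | inj₂ q | inj₁ i<k  = avoidsLast-elim k≤n i<k (avoidsLast s) ∈-++⁺ˡ (∈-++⁺ʳ F q)
  ... | inj₂ q | inj₂ refl = orig∉stageFace s (∈-++⁺ʳ F q)
  cone-vertex : ∀ {x} → x ∈ new k ∷ A ++ B → StageVertex n (suc k) i x
  cone-vertex (here refl) = i≤k , ≤-refl
  cone-vertex {x} (there p) = stageVertex-suc x (vertices s (AB⊆FB p))
  in-A : ∀ {x} → x ∈ F → x ∈ new k ∷ A ++ B → x ∈ A
  in-A q (here refl) = ⊥-elim (new∉Fset q)
  in-A q (there p) = [ (λ a → a) , (λ b → ⊥-elim (B∩F b q)) ] (∈-++⁻ A p)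

stageFace-unsubdivided : k ≤ n → new k ∉ σ → ¬ (Fset n k ⊆ σ) →
  StageFace n (suc k) i σ → StageFace n k i σ
stageFace-unsubdivided {k} k≤n v∉σ F⊄σ s = record
  { vertices    = λ {x} p → stageVertex-pred {k = k} x (λ { refl → v∉σ p }) (vertices s p)
  ; noAntipodes = noAntipodes s
  ; avoidsLast  = avoidsLast-of-centre⊄ k≤n F⊄σ
  }

stageFace-link : k ≤ n → new k ∈ σ → B ⊆ σ → new k ∉ B →
  StageFace n (suc k) i σ → StageFace n k i (Fset n k ++ B)
stageFace-link {k} {n} {σ} {B} {i} k≤n v∈σ B⊆σ v∉B s = record
  { vertices    = link-vertex
  ; noAntipodes = link-antipodes
  ; avoidsLast  = avoidsLast-of-orig∉ (m≤n⇒m≤1+n k≤n)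
                    ([ orig∉Fset-self k≤n , (λ q → noAntipodes s (B⊆σ q) v∈σ) ] ∘ ∈-++⁻ F)
  }
  where
  F = Fset n k
  i≤k : i ≤ k
  i≤k = proj₁ (vertices s v∈σ)
  link-vertex : ∀ {x} → x ∈ F ++ B → StageVertex n k i x
  link-vertex p with ∈-++⁻ F p
  link-vertex {orig j} p | inj₁ q =
    let k<j , j≤ = ∈Fset⁻ k≤n q in j≤ , λ { refl → <⇒≱ k<j i≤k }
  link-vertex {new j}  p | inj₁ q = ⊥-elim (new∉Fset q)
  link-vertex {x}      p | inj₂ q =
    stageVertex-pred {k = k} x (λ { refl → v∉B q }) (vertices s (B⊆σ q))
  link-antipodes : NoAntipodes (F ++ B)
  link-antipodes o nw with ∈-++⁻ F nw
  ... | inj₁ q = new∉Fset q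
  ... | inj₂ q with ∈-++⁻ F o
  ...   | inj₁ r = <⇒≱ (proj₁ (∈Fset⁻ k≤n r)) (≤-pred (proj₂ (vertices s (B⊆σ q))))
  ...   | inj₂ r = noAntipodes s (B⊆σ r) (B⊆σ q)

stellar→stage : All (_≤ suc n) I → k ≤ n →
  stellar (Stage n k I) (Fset n k) (new k) σ → Stage n (suc k) I σ
stellar→stage I≤ k≤n (inj₁ ((i , i∈ , s) , F⊄σ)) = i , i∈ , stageFace-keep s F⊄σ
stellar→stage I≤ k≤n (inj₂ (A , B , (A⊆F , F⊄A) , B∩F , (i , i∈ , s) , σ⊆)) =
  i , i∈ , stageFace-⊆ σ⊆ (stageFace-cone (All.lookup I≤ i∈) k≤n A⊆F F⊄A B∩F s)

stage→stellar : All (_≤ suc n) I → k ≤ n →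
  Stage n (suc k) I σ → stellar (Stage n k I) (Fset n k) (new k) σ
stage→stellar {n} {k = k} {σ} I≤ k≤n (i , i∈ , s) with new k ∈? σ
... | no v∉σ = inj₁ ((i , i∈ , stageFace-unsubdivided k≤n v∉σ F⊄σ s) , F⊄σ)
  where
  F⊄σ : ¬ (Fset n k ⊆ σ)
  F⊄σ = centre⊄stageFace (All.lookup I≤ i∈) s
... | yes v∈σ =
  inj₂ (inside , outside , (filter-holds in-F? σ , F⊄inside) , outside∩F , (i , i∈ , link) , σ⊆cone)
  where
  F = Fset n k
  in-F? : Decidable (_∈ F)
  in-F? = _∈? F
  out? : Decidable (_∉ new k ∷ F)
  out? = ¬? ∘ (_∈? new k ∷ F)
  inside = filter in-F? σ
  outside = filter out? σ
  F⊄inside : ¬ (F ⊆ inside)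
  F⊄inside F⊆inside = centre⊄stageFace (All.lookup I≤ i∈) s (filter-⊆ in-F? σ ∘ F⊆inside)
  outside∩F : ∀ {x} → x ∈ outside → x ∉ F
  outside∩F b = filter-holds out? σ b ∘ there
  link : StageFace n k i (F ++ outside)
  link = stageFace-link k≤n v∈σ (filter-⊆ out? σ) (λ b → filter-holds out? σ b (here refl)) s
  σ⊆cone : σ ⊆ (new k ∷ inside ++ outside)
  σ⊆cone {x} p with x ∈? new k ∷ F
  ... | yes (here refl) = here refl
  ... | yes (there q)   = there (∈-++⁺ˡ (∈-filter⁺ in-F? p q))
  ... | no x∉           = there (∈-++⁺ʳ inside (∈-filter⁺ out? p x∉))

stellar≐stage : All (_≤ suc n) I → k ≤ n →
  stellar (Stage n k I) (Fset n k) (new k) ≐ Stage n (suc k) I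
stellar≐stage I≤ k≤n σ = stellar→stage I≤ k≤n , stage→stellar I≤ k≤n

Γ≐stage₀ : Γ n I ≐ Stage n 0 I
Γ≐stage₀ {n} σ =
  (λ (i , i∈ , in-facet) → i , i∈ , record
     { vertices    = λ {x} → from-facet x ∘ in-facet
     ; noAntipodes = λ _ nw → in-facet nw
     ; avoidsLast  = tt
     }) ,
  (λ (i , i∈ , s) → i , i∈ , λ {x} → to-facet x ∘ vertices s)
  where
  from-facet : ∀ x → inΓfacet n i x → StageVertex n 0 i x
  from-facet (orig j) v = v
  to-facet : ∀ x → StageVertex n 0 i x → inΓfacet n i x
  to-facet (orig j) v = v

steps≐stage : All (_≤ suc n) I → k ≤ suc n → steps n k (Γ n I) ≐ Stage n k I
steps≐stage {k = zero}  _  _         = Γ≐stage₀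
steps≐stage {k = suc k} I≤ (s≤s k≤n) =
  ≐-trans (stellar-cong (steps≐stage I≤ (m≤n⇒m≤1+n k≤n))) (stellar≐stage I≤ k≤n)

-- ◇^n(Γ^n_i) is the full subcomplex of the boundary of the cross-polytope on these vertices.

CrossVertex : ℕ → ℕ → V → Set
CrossVertex n i (orig j) = j ≤ n × j ≢ i
CrossVertex n i (new j)  = i ≤ j × j ≤ n

record CrossFace (n i : ℕ) (σ : Face) : Set where
  field
    vertices    : ∀ {x} → x ∈ σ → CrossVertex n i x
    noAntipodes : NoAntipodes σ
open CrossFace

Cross : ℕ → List ℕ → Complex
Cross n I σ = ∃[ i ] i ∈ I × CrossFace n i σ

stageFace⇒crossFace : i ≤ suc n → StageFace n (suc n) i σ → CrossFace n i σ
stageFace⇒crossFace {i} {n} {σ} i≤ s = record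
  { vertices = cross-vertex ; noAntipodes = StageFace.noAntipodes s }
  where
  cross-vertex : ∀ {x} → x ∈ σ → CrossVertex n i x
  cross-vertex {new j} p = let i≤j , j<1+n = StageFace.vertices s p in i≤j , ≤-pred j<1+n
  cross-vertex {orig j} p with StageFace.vertices s p
  ... | j≤ , j≢i with m≤n⇒m<n∨m≡n j≤
  ...   | inj₁ j<1+n = ≤-pred j<1+n , j≢i
  ...   | inj₂ refl  = ⊥-elim (avoidsLast s (≤-pred (≤∧≢⇒< i≤ (j≢i ∘ sym)))
                                 (λ q → subst (_∈ σ) (sym (Fset-top q)) p))

crossFace⇒stageFace : CrossFace n i σ → StageFace n (suc n) i σ
crossFace⇒stageFace {n} {i} c = record
  { vertices    = λ {x} → stage-vertex x ∘ CrossFace.vertices c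
  ; noAntipodes = CrossFace.noAntipodes c
  ; avoidsLast  = λ _ F⊆σ → 1+n≰n (proj₁ (CrossFace.vertices c (F⊆σ (∈Fset⁺ ≤-refl ≤-refl))))
  }
  where
  stage-vertex : ∀ x → CrossVertex n i x → StageVertex n (suc n) i x
  stage-vertex (orig j) (j≤n , j≢i) = m≤n⇒m≤1+n j≤n , j≢i
  stage-vertex (new j)  (i≤j , j≤n) = i≤j , s≤s j≤n

stage≐cross : All (_≤ suc n) I → Stage n (suc n) I ≐ Cross n I
stage≐cross I≤ σ = (λ (i , i∈ , s) → i , i∈ , stageFace⇒crossFace (All.lookup I≤ i∈) s)
                 , (λ (i , i∈ , c) → i , i∈ , crossFace⇒stageFace c)

diamond≐cross : All (_≤ suc n) I → Diamond n (Γ n I) ≐ Cross n I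
diamond≐cross I≤ = ≐-trans (steps≐stage I≤ ≤-refl) (stage≐cross I≤)

crossFace-⊆ : τ ⊆ σ → CrossFace n i σ → CrossFace n i τ
crossFace-⊆ τ⊆σ c = record
  { vertices = vertices c ∘ τ⊆σ ; noAntipodes = noAntipodes-⊆ τ⊆σ (noAntipodes c) }

crossFace-++ : CrossFace n i A → CrossFace n i B →
  (∀ {x y} → x ∈ A → y ∈ B → level x ≢ level y) → CrossFace n i (A ++ B)
crossFace-++ {A = A} a b apart = record
  { vertices    = [ vertices a , vertices b ] ∘ ∈-++⁻ A
  ; noAntipodes = noAntipodes-++ (noAntipodes a) (noAntipodes b) apart
  }

crossVertex-level : ∀ x → CrossVertex n i x → level x ≤ n
crossVertex-level (orig j) (j≤n , _) = j≤n
crossVertex-level (new j)  (_ , j≤n) = j≤n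

crossFace-suc : CrossFace n i σ → CrossFace (suc n) i σ
crossFace-suc c = record
  { vertices = λ {x} → lift x ∘ vertices c ; noAntipodes = noAntipodes c }
  where
  lift : ∀ x → CrossVertex _ _ x → CrossVertex (suc _) _ x
  lift (orig j) (j≤n , j≢i) = m≤n⇒m≤1+n j≤n , j≢i
  lift (new j)  (i≤j , j≤n) = i≤j , m≤n⇒m≤1+n j≤n

crossFace-pred : (∀ {x} → x ∈ σ → level x ≢ suc n) → CrossFace (suc n) i σ → CrossFace n i σ
crossFace-pred below c = record
  { vertices = λ {x} p → lower x (below p) (vertices c p) ; noAntipodes = noAntipodes c }
  where
  lower : ∀ x → level x ≢ suc _ → CrossVertex (suc _) _ x → CrossVertex _ _ x
  lower (orig j) j≢ (j≤ , j≢i) = ≤-pred (≤∧≢⇒< j≤ j≢) , j≢i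
  lower (new j)  j≢ (i≤j , j≤) = i≤j , ≤-pred (≤∧≢⇒< j≤ j≢)

crossFace-πv⁻ : CrossFace (suc n) (suc i) (map πv τ) → CrossFace n i τ
crossFace-πv⁻ c = record
  { vertices    = λ {x} → lower x ∘ vertices c ∘ ∈-map⁺ πv
  ; noAntipodes = λ o nw → noAntipodes c (∈-map⁺ πv o) (∈-map⁺ πv nw)
  }
  where
  lower : ∀ x → CrossVertex (suc _) (suc _) (πv x) → CrossVertex _ _ x
  lower (orig j) (j≤ , j≢i) = ≤-pred j≤ , j≢i ∘ cong suc
  lower (new j)  (i≤j , j≤) = ≤-pred i≤j , ≤-pred j≤

crossFace-πv⁺ : CrossFace n i τ → CrossFace (suc n) (suc i) (map πv τ)
crossFace-πv⁺ {n} {i} {τ} c = record { vertices = raised-vertex ; noAntipodes = raised-antipodes }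
  where
  raise : ∀ x → CrossVertex n i x → CrossVertex (suc n) (suc i) (πv x)
  raise (orig j) (j≤ , j≢i) = s≤s j≤ , j≢i ∘ suc-injective
  raise (new j)  (i≤j , j≤) = s≤s i≤j , s≤s j≤
  raised-vertex : ∀ {x} → x ∈ map πv τ → CrossVertex (suc n) (suc i) x
  raised-vertex q with ∈-map⁻ πv q
  ... | y , y∈ , refl = raise y (vertices c y∈)
  raised-antipodes : NoAntipodes (map πv τ)
  raised-antipodes o nw with ∈-map⁻ πv o | ∈-map⁻ πv nw
  ... | orig a , a∈ , refl | new .a , b∈ , refl = noAntipodes c a∈ b∈

-- Part (1): split off the vertices of level d = suc e.

twoPts-level : ∀ {d} → NoAntipodes A → (∀ {x} → x ∈ A → level x ≡ d) → twoPts (orig d) (new d) A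
twoPts-level {A} {d} anti at-d with new d ∈? A
... | yes v∈ = inj₂ only-new
  where
  only-new : A ⊆ (new d ∷ [])
  only-new {x} p with level-fibre {x} (at-d p)
  ... | inj₁ refl = ⊥-elim (anti p v∈)
  ... | inj₂ refl = here refl
... | no v∉ = inj₁ only-orig
  where
  only-orig : A ⊆ (orig d ∷ [])
  only-orig {x} p with level-fibre {x} (at-d p)
  ... | inj₁ refl = here refl
  ... | inj₂ refl = ⊥-elim (v∉ p)

crossFace-singleton : ∀ {c} → CrossVertex n i c → A ⊆ (c ∷ []) → CrossFace n i A
crossFace-singleton {n} {i} {A} v A⊆c = record
  { vertices = singleton-vertex ; noAntipodes = noAntipodes-singleton A⊆c }
  where
  singleton-vertex : ∀ {x} → x ∈ A → CrossVertex n i x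
  singleton-vertex p with A⊆c p
  ... | here refl = v

twoPts-crossFace : ∀ {d} → i ≤ d → i ≢ d → twoPts (orig d) (new d) A → CrossFace d i A
twoPts-crossFace i≤d i≢d (inj₁ A⊆d) = crossFace-singleton (≤-refl , i≢d ∘ sym) A⊆d
twoPts-crossFace i≤d i≢d (inj₂ A⊆v) = crossFace-singleton (i≤d , ≤-refl) A⊆v

twoPts-level⁻ : ∀ {d} → twoPts (orig d) (new d) A → x ∈ A → level x ≡ d
twoPts-level⁻ (inj₁ A⊆d) p with A⊆d p
... | here refl = refl
twoPts-level⁻ (inj₂ A⊆v) p with A⊆v p
... | here refl = refl

cross-split-top : All (_≤ suc e) I → suc e ∉ I →
  Cross (suc e) I ≐ (twoPts (orig (suc e)) (new (suc e)) ✶ Cross e I)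
cross-split-top {e} {I} I≤ d∉I σ = split , merge
  where
  at-top? : Decidable (λ x → level x ≡ suc e)
  at-top? x = level x ≟ suc e
  split : Cross (suc e) I σ → (twoPts (orig (suc e)) (new (suc e)) ✶ Cross e I) σ
  split (i , i∈ , c) = ✶-intro at-top?
    (twoPts-level (noAntipodes-⊆ (filter-⊆ at-top? σ) (noAntipodes c)) (filter-holds at-top? σ))
    (i , i∈ , crossFace-pred (filter-holds (¬? ∘ at-top?) σ)
                             (crossFace-⊆ (filter-⊆ (¬? ∘ at-top?) σ) c))
  merge : (twoPts (orig (suc e)) (new (suc e)) ✶ Cross e I) σ → Cross (suc e) I σ
  merge (A , B , top , (i , i∈ , c) , σ≈) = i , i∈ , crossFace-⊆ (proj₁ σ≈)
    (crossFace-++ (twoPts-crossFace i≤d (λ { refl → d∉I i∈ }) top) (crossFace-suc c) apart)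
    where
    i≤d : i ≤ suc e
    i≤d = All.lookup I≤ i∈
    apart : ∀ {x y} → x ∈ A → y ∈ B → level x ≢ level y
    apart {y = y} p q eq =
      1+n≰n (subst (_≤ e) (trans (sym eq) (twoPts-level⁻ top p)) (crossVertex-level y (vertices c q)))

-- Part (2): split off the vertex 0 and shift the rest down.

∈-shiftDown⁺ : suc i ∈ I → i ∈ shiftDown I
∈-shiftDown⁺ = ∈-map⁺ (_∸ 1)

∈-shiftDown⁻ : 0 ∉ I → i ∈ shiftDown I → suc i ∈ I
∈-shiftDown⁻ 0∉I p with ∈-map⁻ (_∸ 1) p
... | zero  , 0∈ , _    = ⊥-elim (0∉I 0∈)
... | suc j , j∈ , refl = j∈

shiftDown-≤ : All (_≤ n) I → All (_≤ n) (shiftDown I)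
shiftDown-≤ I≤ = All.map⁺ (All.map (λ {j} → ≤-trans (m∸n≤m j 1)) I≤)

cross-split-bottom : 0 ∉ I →
  Cross (suc e) I ≐ (onePt (orig 0) ✶ image πv (Cross e (shiftDown I)))
cross-split-bottom {I} {e} 0∉I σ = split , merge
  where
  at-bottom? : Decidable (λ x → level x ≡ 0)
  at-bottom? x = level x ≟ 0
  above? : Decidable (λ x → level x ≢ 0)
  above? = ¬? ∘ at-bottom?
  split : Cross (suc e) I σ → (onePt (orig 0) ✶ image πv (Cross e (shiftDown I))) σ
  split (zero  , i∈ , c) = ⊥-elim (0∉I i∈)
  split (suc i , i∈ , c) = ✶-intro at-bottom? (λ {x} → bottom {x})
    (map unπ upper ,
     (i , ∈-shiftDown⁺ i∈ , crossFace-πv⁻ (crossFace-⊆ (upper⊆σ ∘ proj₂ upper≈) c)) ,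
     upper≈)
    where
    upper : Face
    upper = filter above? σ
    upper⊆σ : upper ⊆ σ
    upper⊆σ = filter-⊆ above? σ
    upper≈ : upper ≈ map πv (map unπ upper)
    upper≈ = map-retraction (πv-unπ ∘ filter-holds above? σ)
    bottom : onePt (orig 0) (filter at-bottom? σ)
    bottom {x} p with level-fibre {x} (filter-holds at-bottom? σ p)
    ... | inj₁ refl = here refl
    ... | inj₂ refl with vertices c (filter-⊆ at-bottom? σ p)
    ...   | () , _
  merge : (onePt (orig 0) ✶ image πv (Cross e (shiftDown I))) σ → Cross (suc e) I σ
  merge (A , B , A⊆0 , (τ , (i , i∈ , c) , B≈) , σ≈) = suc i , ∈-shiftDown⁻ 0∉I i∈ ,
    crossFace-⊆ (proj₁ σ≈) (crossFace-++ (crossFace-singleton (z≤n , λ ()) A⊆0)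
                              (crossFace-⊆ (proj₁ B≈) (crossFace-πv⁺ c)) apart)
    where
    apart : ∀ {x y} → x ∈ A → y ∈ B → level x ≢ level y
    apart p q with A⊆0 p | ∈-map⁻ πv (proj₁ B≈ q)
    ... | here refl | y , _ , refl = λ eq → 0≢1+n (trans eq (level-πv y))

lemma4p9 : (e : ℕ) (I : List ℕ) → All (_≤ suc e) I →
    ((suc e ∉ I →
        Diamond (suc e) (Γ (suc e) I)
          ≐ (twoPts (orig (suc e)) (new (suc e)) ✶ Diamond e (Γ e I)))
    × (0 ∉ I →
        Diamond (suc e) (Γ (suc e) I)
          ≐ (onePt (orig 0) ✶ image πv (Diamond e (Γ e (shiftDown I))))))
lemma4p9 e I I≤ =
  (λ d∉I → ≐-trans diamond-suc
             (≐-trans (cross-split-top I≤ d∉I) (✶-congʳ (≐-sym (diamond≐cross I≤))))) ,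
  (λ 0∉I → ≐-trans diamond-suc
             (≐-trans (cross-split-bottom 0∉I)
                      (✶-congʳ (image-cong (≐-sym (diamond≐cross (shiftDown-≤ I≤)))))))
  where
  diamond-suc : Diamond (suc e) (Γ (suc e) I) ≐ Cross (suc e) I
  diamond-suc = diamond≐cross (All.map m≤n⇒m≤1+n I≤)
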